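{- Let $D=(V,E)$ be a finite strongly connected digraph without loops, let $t\in V$, and consider configurations $f:V\to\{\text{robot},\text{obstacle},\text{hole}\}$ with exactly one robot. Then: (i) if, in a configuration $f$, the robot and some hole lie on vertices of the same cycle $C$ of $D$, then for every vertex $u$ of $C$ there is a finite sequence of moves from $f$ after which the robot is at $u$; (ii) if $f'$ is obtained from $f$ by a single move, then the robot can be brought to $t$ by a finite sequence of moves starting from $f$ if and only if it can be brought to $t$ by a finite sequence of moves starting from $f'$.
   Context: A move consists of choosing an arc $(v,w)\in E$ such that $v$ holds an object (the robot or an obstacle) and $w$ holds a hole (is empty), and moving the object from $v$ to $w$ (so $v$ becomes a hole). A cycle is a sequence of pairwise distinct vertices $v_0\dots v_k$ with $(v_i,v_{i+1})\in E$ for all $i$, indices mod $k+1$. -}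

module Defs where

open import Data.Nat using (ℕ; suc)
open import Data.Nat.DivMod using (_mod_)
open import Data.Fin using (Fin; toℕ; _≟_)
open import Data.Product using (Σ; ∃; _×_)
open import Relation.Nullary using (¬_; does)
open import Relation.Binary.PropositionalEquality using (_≡_; _≢_)
open import Relation.Binary.Construct.Closure.ReflexiveTransitive using (Star)
open import Function.Definitions using (Injective)
open import Data.Bool using (if_then_else_)

Digraph : ℕ → Set₁
Digraph n = Fin n → Fin n → Set

Loopless : ∀ {n} → Digraph n → Set
Loopless {n} E = (v : Fin n) → ¬ E v v

StronglyConnected : ∀ {n} → Digraph n → Set
StronglyConnected {n} E = (u v : Fin n) → Star E u v

data Cell : Set where
  robot obstacle hole : Cell

Config : ℕ → Set
Config n = Fin n → Cell

ExactlyOneRobot : ∀ {n} → Config n → Set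
ExactlyOneRobot {n} f = Σ (Fin n) λ r → (f r ≡ robot) × ((v : Fin n) → f v ≡ robot → v ≡ r)

moveCfg : ∀ {n} → Config n → Fin n → Fin n → Config n
moveCfg f v w x =
  if does (x ≟ v) then hole else (if does (x ≟ w) then f v else f x)

data Move {n} (E : Digraph n) (f : Config n) : Config n → Set where
  move : (v w : Fin n) → E v w → f v ≢ hole → f w ≡ hole → Move E f (moveCfg f v w)

Moves : ∀ {n} → Digraph n → Config n → Config n → Set
Moves E = Star (Move E)

CanReach : ∀ {n} → Digraph n → Config n → Fin n → Set
CanReach {n} E f u = ∃ λ g → Moves E f g × g u ≡ robot

next : ∀ {k} → Fin (suc k) → Fin (suc k)
next {k} i = suc (toℕ i) mod suc k

IsCycle : ∀ {n} → Digraph n → (k : ℕ) → (Fin (suc k) → Fin n) → Set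
IsCycle E k c = Injective _≡_ _≡_ c × (∀ i → E (c i) (c (next i)))

module Submission where

-- Both parts rest on rotating a cycle. If q 0 → … → q L is a path of distinct vertices ending
-- at a hole, the moves q (L-1) → q L, …, q 0 → q 1 (skipping those whose source is empty)
-- push every content one step forward and leave a hole at q 0 (module PathShift). On a cyclic
-- walk C of period k + 1 with a hole at C p, the path of length k running from C (p + 1) round
-- to C p thus advances every content of the cycle by one step (Rotation.rotate); iterating,
-- any content of the cycle can be brought to any vertex of it.
-- For part (ii) we show that every move (v, w) can be undone. Strong connectivity gives a
-- simple path from w back to v, which together with the arc v → w is a cyclic walk (Paths).
-- The move is the first move of a rotation of this cycle; completing that rotation and doing
-- k more turns the cycle once fully around, which restores the configuration up to pointwise
-- equality, and move sequences can be replayed along pointwise equal configurations.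

open import Defs
open import Data.Nat using (ℕ; zero; suc; _+_; _*_; _∸_; _<_; _≤_; _%_; _/_; s≤s; NonZero)
open import Data.Nat.Properties
  using (≤-refl; <⇒≤; <⇒≢; m<n⇒m<1+n; m≤n⇒m≤1+n; n≤1+n; m<1+n⇒m<n∨m≡n; _<?_; ≮⇒≥; m<n+m;
         m+[n∸m]≡n; m∸n+n≡m; <-trans; ≤-trans; m∸n≤m; m<n⇒0<n∸m; +-comm; +-cancelˡ-<; +-monoˡ-<; +-assoc; +-suc; +-identityʳ)
open import Data.Nat.DivMod using (m≡m%n+[m/n]*n; m%n<n; _mod_; m<n⇒m%n≡m; [m+n]%n≡m%n; [m+kn]%n≡m%n)
open import Data.Nat.Tactic.RingSolver using (solve)
open import Data.List using (List; []; _∷_; length)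
open import Data.List.Relation.Unary.Any using (here; there)
open import Data.List.Relation.Unary.All using ([]) renaming (lookup to all-lookup)
open import Data.List.Relation.Unary.All.Properties using (¬Any⇒All¬)
open import Data.List.Relation.Unary.Unique.Propositional using (Unique; []; _∷_)
open import Data.List.Membership.Propositional using (_∈_)
open import Data.Fin using (Fin; _≟_; toℕ)
open import Data.Fin.Properties using (any?; toℕ-fromℕ<; toℕ-injective; toℕ<n)
open import Data.Product using (∃; _×_; _,_; proj₁; proj₂)
open import Data.Sum using (_⊎_; inj₁; inj₂)
open import Data.Empty using (⊥-elim)
open import Relation.Nullary using (Dec; yes; no)
open import Relation.Binary.PropositionalEquality
open import Function.Bundles using (_⇔_; mk⇔)
open import Relation.Binary.Construct.Closure.ReflexiveTransitive using (Star; ε; _◅_; _◅◅_)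

module _ {n : ℕ} where

  moveCfg-source : (f : Config n) (v w : Fin n) → moveCfg f v w v ≡ hole
  moveCfg-source f v w with v ≟ v
  ... | yes _ = refl
  ... | no v≢v = ⊥-elim (v≢v refl)

  moveCfg-target : (f : Config n) (v w : Fin n) → v ≢ w → moveCfg f v w w ≡ f v
  moveCfg-target f v w v≢w with w ≟ v
  ... | yes w≡v = ⊥-elim (v≢w (sym w≡v))
  ... | no _ with w ≟ w
  ...   | yes _ = refl
  ...   | no w≢w = ⊥-elim (w≢w refl)

  moveCfg-other : (f : Config n) (v w x : Fin n) → x ≢ v → x ≢ w → moveCfg f v w x ≡ f x
  moveCfg-other f v w x x≢v x≢w with x ≟ v
  ... | yes x≡v = ⊥-elim (x≢v x≡v)
  ... | no _ with x ≟ w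
  ...   | yes x≡w = ⊥-elim (x≢w x≡w)
  ...   | no _ = refl

  moveCfg-cong : {f f′ : Config n} → f ≗ f′ → (v w : Fin n) → moveCfg f v w ≗ moveCfg f′ v w
  moveCfg-cong f≗f′ v w x with x ≟ v
  ... | yes _ = refl
  ... | no _ with x ≟ w
  ...   | yes _ = f≗f′ v
  ...   | no _ = f≗f′ x

  moves-transport : {E : Digraph n} {f g f′ : Config n} → Moves E f g → f ≗ f′ →
                    ∃ λ g′ → Moves E f′ g′ × g ≗ g′
  moves-transport ε f≗f′ = _ , ε , f≗f′
  moves-transport (move v w e v-full w-hole ◅ ms) f≗f′
    with moves-transport ms (moveCfg-cong f≗f′ v w)
  ... | g′ , ms′ , g≗g′ =
    g′ , move v w e (λ eq → v-full (trans (f≗f′ v) eq)) (trans (sym (f≗f′ w)) w-hole) ◅ ms′ , g≗g′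

isHole : (c : Cell) → Dec (c ≡ hole)
isHole robot = no λ ()
isHole obstacle = no λ ()
isHole hole = yes refl

module PathShift {n : ℕ} (E : Digraph n) (q : ℕ → Fin n) where

  IsWalk : ℕ → Set
  IsWalk L = ∀ j → j < L → E (q j) (q (suc j))

  Distinct : ℕ → Set
  Distinct L = ∀ i j → i < j → j ≤ L → q i ≢ q j

  OffPath : ℕ → Fin n → Set
  OffPath L x = ∀ j → j ≤ L → q j ≢ x

  Shifted : ℕ → Config n → Config n → Set
  Shifted L h g = (g (q 0) ≡ hole)
                × (∀ j → j < L → g (q (suc j)) ≡ h (q j))
                × (∀ x → OffPath L x → g x ≡ h x)

  private
    last-off : ∀ {L} → Distinct (suc L) → OffPath L (q (suc L))
    last-off distinct j j≤L = distinct j _ (s≤s j≤L) ≤-refl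

    walk-init : ∀ {L} → IsWalk (suc L) → IsWalk L
    walk-init walk j j<L = walk j (m<n⇒m<1+n j<L)

    distinct-init : ∀ {L} → Distinct (suc L) → Distinct L
    distinct-init distinct i j i<j j≤L = distinct i j i<j (m≤n⇒m≤1+n j≤L)

    shorter-off : ∀ {L x} → OffPath (suc L) x → OffPath L x
    shorter-off off j j≤L = off j (m≤n⇒m≤1+n j≤L)

  shifted-after-move : ∀ L h g → Distinct (suc L) →
                       Shifted L (moveCfg h (q L) (q (suc L))) g → Shifted (suc L) h g
  shifted-after-move L h g distinct (g-start , g-path , g-off) = g-start , path , off
    where
    path : ∀ j → j < suc L → g (q (suc j)) ≡ h (q j)
    path j j<1+L with m<1+n⇒m<n∨m≡n j<1+L
    ... | inj₁ j<L = trans (g-path j j<L)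
            (moveCfg-other h _ _ (q j) (distinct j L j<L (n≤1+n L)) (last-off distinct j (<⇒≤ j<L)))
    ... | inj₂ refl = trans (g-off _ (last-off distinct))
            (moveCfg-target h _ _ (last-off distinct L ≤-refl))
    off : ∀ x → OffPath (suc L) x → g x ≡ h x
    off x x-off = trans (g-off x (shorter-off x-off))
      (moveCfg-other h _ _ x (λ x≡ → x-off L (n≤1+n L) (sym x≡)) (λ x≡ → x-off (suc L) ≤-refl (sym x≡)))

  shifted-idle : ∀ L h g → Distinct (suc L) → h (q L) ≡ hole → h (q (suc L)) ≡ hole →
                 Shifted L h g → Shifted (suc L) h g
  shifted-idle L h g distinct hL hL+1 (g-start , g-path , g-off) = g-start , path , off
    where
    path : ∀ j → j < suc L → g (q (suc j)) ≡ h (q j)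
    path j j<1+L with m<1+n⇒m<n∨m≡n j<1+L
    ... | inj₁ j<L = g-path j j<L
    ... | inj₂ refl = trans (g-off _ (last-off distinct)) (trans hL+1 (sym hL))
    off : ∀ x → OffPath (suc L) x → g x ≡ h x
    off x x-off = g-off x (shorter-off x-off)

  shift-path : ∀ L → IsWalk L → Distinct L → ∀ h → h (q L) ≡ hole →
               ∃ λ g → Moves E h g × Shifted L h g
  shift-path zero _ _ h h-end = h , ε , h-end , (λ _ ()) , (λ _ _ → refl)
  shift-path (suc L) walk distinct h h-end with isHole (h (q L))
  ... | yes hL with shift-path L (walk-init walk) (distinct-init distinct) h hL
  ...   | g , ms , shifted = g , ms , shifted-idle L h g distinct hL h-end shifted
  shift-path (suc L) walk distinct h h-end | no hL
    with shift-path L (walk-init walk) (distinct-init distinct)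
                    (moveCfg h (q L) (q (suc L))) (moveCfg-source h (q L) (q (suc L)))
  ... | g , ms , shifted =
    g , move _ _ (walk L ≤-refl) hL h-end ◅ ms , shifted-after-move L h g distinct shifted

module Periodic {A : Set} (N : ℕ) .{{_ : NonZero N}} (C : ℕ → A) (periodic : ∀ i → C (N + i) ≡ C i) where

  periodic-multiple : ∀ a m → C (a + m * N) ≡ C a
  periodic-multiple a zero = cong C (+-identityʳ a)
  periodic-multiple a (suc m) = begin
    C (a + (N + m * N)) ≡⟨ cong C (solve (a ∷ N ∷ m ∷ [])) ⟩
    C (N + (a + m * N)) ≡⟨ periodic _ ⟩
    C (a + m * N)       ≡⟨ periodic-multiple a m ⟩
    C a                 ∎
    where open ≡-Reasoning

  periodic-residue : ∀ a i → C (a + i) ≡ C (a + i % N)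
  periodic-residue a i = begin
    C (a + i)                      ≡⟨ cong (λ j → C (a + j)) (m≡m%n+[m/n]*n i N) ⟩
    C (a + (i % N + (i / N) * N))  ≡⟨ cong C (sym (+-assoc a _ _)) ⟩
    C (a + i % N + (i / N) * N)    ≡⟨ periodic-multiple _ (i / N) ⟩
    C (a + i % N)                  ∎
    where open ≡-Reasoning

  no-short-repeat : (∀ i j → i < N → j < N → C i ≡ C j → i ≡ j) →
                    ∀ d i → 0 < d → d < N → C (d + i) ≢ C i
  no-short-repeat inj d i 0<d d<N eq with d + i % N <? N
  ... | yes d+r<N = <⇒≢ (m<n+m r 0<d) (sym (inj _ _ d+r<N r<N eq′))
    where
    r = i % N
    r<N = m%n<n i N
    eq′ : C (d + r) ≡ C r
    eq′ = trans (sym (periodic-residue d i)) (trans eq (periodic-residue 0 i))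
  ... | no d+r≮N = <⇒≢ e<r (inj _ _ (<-trans e<r r<N) r<N eq′)
    where
    r = i % N
    r<N = m%n<n i N
    e = d + r ∸ N
    d+r≡N+e : N + e ≡ d + r
    d+r≡N+e = m+[n∸m]≡n (≮⇒≥ d+r≮N)
    e<r : e < r
    e<r = +-cancelˡ-< N e r (subst (_< N + r) (sym d+r≡N+e) (+-monoˡ-< r d<N))
    eq′ : C e ≡ C r
    eq′ = begin
      C e       ≡⟨ sym (periodic e) ⟩
      C (N + e) ≡⟨ cong C d+r≡N+e ⟩
      C (d + r) ≡⟨ sym (periodic-residue d i) ⟩
      C (d + i) ≡⟨ eq ⟩
      C i       ≡⟨ periodic-residue 0 i ⟩
      C r       ∎
      where open ≡-Reasoning

record Cyclic {n : ℕ} (E : Digraph n) (k : ℕ) (C : ℕ → Fin n) : Set where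
  field
    periodic : ∀ i → C (suc k + i) ≡ C i
    arc : ∀ i → E (C i) (C (suc i))
    no-repeat : ∀ d i → 0 < d → d < suc k → C (d + i) ≢ C i

module Rotation {n : ℕ} (E : Digraph n) {k : ℕ} {C : ℕ → Fin n} (cyc : Cyclic E k C) where
  open Cyclic cyc
  open Periodic (suc k) C periodic

  OffCycle : Fin n → Set
  OffCycle x = ∀ i → C i ≢ x

  RotatedBy : ℕ → Config n → Config n → Set
  RotatedBy m h g = (∀ i → g (C (m + i)) ≡ h (C i)) × (∀ x → OffCycle x → g x ≡ h x)

  -- p whole turns of the cycle, i.e. p * (k + 1) steps, lead back to the same vertex.
  turns : ∀ a p i → C (a + (p + (p * k + i))) ≡ C (a + i)
  turns a p i = trans (cong C whole-turns) (periodic-multiple (a + i) p)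
    where
    whole-turns : a + (p + (p * k + i)) ≡ a + i + p * suc k
    whole-turns = solve (a ∷ p ∷ k ∷ i ∷ [])

  window : ∀ p i → ∃ λ r → r < suc k × C (p + r) ≡ C i × C (suc (p + r)) ≡ C (suc i)
  window p i = s % suc k , m%n<n s (suc k) ,
    trans (sym (periodic-residue p s)) (turns 0 p i) ,
    trans (sym (periodic-residue (suc p) s)) (turns 1 p i)
    where s = p * k + i

  module Window (p : ℕ) where
    q : ℕ → Fin n
    q j = C (suc (p + j))

    open PathShift E q public

    walk : ∀ L → IsWalk L
    walk L j _ = subst (λ x → E (q j) (C x)) (cong suc (sym (+-suc p j))) (arc (suc (p + j)))

    distinct : ∀ L → L ≤ k → Distinct L
    distinct L L≤k i j i<j j≤L qi≡qj =
      no-repeat (j ∸ i) (suc (p + i)) (m<n⇒0<n∸m i<j) (s≤s (≤-trans (m∸n≤m j i) (≤-trans j≤L L≤k)))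
        (trans (cong C steps) (sym qi≡qj))
      where
      steps : j ∸ i + suc (p + i) ≡ suc (p + j)
      steps = begin
        j ∸ i + suc (p + i)   ≡⟨ rearrange (j ∸ i) ⟩
        suc (p + (j ∸ i + i)) ≡⟨ cong (λ x → suc (p + x)) (m∸n+n≡m (<⇒≤ i<j)) ⟩
        suc (p + j)           ∎
        where
        open ≡-Reasoning
        rearrange : ∀ d → d + suc (p + i) ≡ suc (p + (d + i))
        rearrange d = solve (d ∷ p ∷ i ∷ [])

    ends-at-start : q k ≡ C p
    ends-at-start = trans (cong (λ x → C (suc x)) (+-comm p k)) (periodic p)

    shifted⇒rotated : ∀ h g → h (C p) ≡ hole → Shifted k h g → RotatedBy 1 h g
    shifted⇒rotated h g hp (g-start , g-path , g-off) = on-cycle , λ x off → g-off x (λ j _ → off _)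
      where
      on-cycle : ∀ i → g (C (suc i)) ≡ h (C i)
      on-cycle i with window p i
      ... | zero , _ , at-i , after-i = begin
        g (C (suc i))       ≡⟨ cong g (sym after-i) ⟩
        g (q 0)             ≡⟨ g-start ⟩
        hole                ≡⟨ sym hp ⟩
        h (C p)             ≡⟨ cong (λ x → h (C x)) (sym (+-identityʳ p)) ⟩
        h (C (p + 0))       ≡⟨ cong h at-i ⟩
        h (C i)             ∎
        where open ≡-Reasoning
      ... | suc j , s≤s j<k , at-i , after-i = begin
        g (C (suc i))       ≡⟨ cong g (sym after-i) ⟩
        g (q (suc j))       ≡⟨ g-path j j<k ⟩
        h (q j)             ≡⟨ cong (λ x → h (C x)) (sym (+-suc p j)) ⟩
        h (C (p + suc j))   ≡⟨ cong h at-i ⟩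
        h (C i)             ∎
        where open ≡-Reasoning

  rotate : ∀ p h → h (C p) ≡ hole → ∃ λ g → Moves E h g × RotatedBy 1 h g
  rotate p h hp with shift-path k (walk k) (distinct k ≤-refl) h (trans (cong h ends-at-start) hp)
    where open Window p
  ... | g , ms , shifted = g , ms , Window.shifted⇒rotated p h g hp shifted

  rotated-compose : ∀ {a b h g g′} → RotatedBy a h g → RotatedBy b g g′ → RotatedBy (a + b) h g′
  rotated-compose {a} {b} {h} {g} {g′} (h→g , h-off) (g→g′ , g-off) = on-cycle , λ x off → trans (g-off x off) (h-off x off)
    where
    on-cycle : ∀ i → g′ (C (a + b + i)) ≡ h (C i)
    on-cycle i = begin
      g′ (C (a + b + i))   ≡⟨ cong (λ x → g′ (C x)) (solve (a ∷ b ∷ i ∷ [])) ⟩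
      g′ (C (b + (a + i))) ≡⟨ g→g′ (a + i) ⟩
      g (C (a + i))        ≡⟨ h→g i ⟩
      h (C i)              ∎
      where open ≡-Reasoning

  -- Rotating m times; after each rotation the hole has advanced one step.
  iterate : ∀ m p h → h (C p) ≡ hole → ∃ λ g → Moves E h g × RotatedBy m h g
  iterate zero p h hp = h , ε , (λ _ → refl) , (λ _ _ → refl)
  iterate (suc m) p h hp with rotate p h hp
  ... | g , ms , rotated with iterate m (suc p) g (trans (proj₁ rotated p) hp)
  ...   | g′ , ms′ , rotated′ = g′ , ms ◅◅ ms′ , rotated-compose rotated rotated′

  reach-position : ∀ p h → h (C p) ≡ hole → ∀ i j → ∃ λ g → Moves E h g × g (C j) ≡ h (C i)
  reach-position p h hp i j with iterate (j + i * k) p h hp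
  ... | g , ms , rotated , _ = g , ms , trans (cong g j-again) (rotated i)
    where
    j-again : C j ≡ C (j + i * k + i)
    j-again = trans (sym (periodic-multiple j i)) (cong C (solve (j ∷ i ∷ k ∷ [])))

  on-or-off : ∀ x → (∃ λ i → C i ≡ x) ⊎ OffCycle x
  on-or-off x with any? (λ (r : Fin (suc k)) → C (toℕ r) ≟ x)
  ... | yes (r , Cr≡x) = inj₁ (toℕ r , Cr≡x)
  ... | no none = inj₂ λ i Ci≡x → none (i mod suc k ,
          trans (cong C (toℕ-fromℕ< (m%n<n i (suc k)))) (trans (sym (periodic-residue 0 i)) Ci≡x))

  full-turn : ∀ {h g} → RotatedBy (suc k) h g → g ≗ h
  full-turn {h} {g} (on-cycle , off-cycle) x with on-or-off x
  ... | inj₁ (i , refl) = trans (cong g (sym (periodic i))) (on-cycle i)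
  ... | inj₂ off = off-cycle x off

complete-rotation : ∀ {n} {E : Digraph n} {k C} (cyc : Cyclic E (suc k) C) h →
  h (C 0) ≡ hole → ∃ λ g → Moves E (moveCfg h (C (suc k)) (C 0)) g × Rotation.RotatedBy E cyc 1 h g
complete-rotation {E = E} {k} {C} cyc h h0
  with shift-path k (walk k) (distinct k (n≤1+n k)) (moveCfg h (q k) (q (suc k)))
                  (moveCfg-source h (q k) (q (suc k)))
  where open Rotation.Window E cyc 0
... | g , ms , shifted =
  g , subst (λ x → Moves E (moveCfg h (C (suc k)) x) g) ends-at-start ms ,
  shifted⇒rotated h g h0 (shifted-after-move k h g (distinct (suc k) ≤-refl) shifted)
  where open Rotation.Window E cyc 0

module CycleWalk {n : ℕ} (E : Digraph n) (k : ℕ) (c : Fin (suc k) → Fin n) (cycle : IsCycle E k c) where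

  C : ℕ → Fin n
  C i = c (i mod suc k)

  mod-cong : ∀ a b → a % suc k ≡ b % suc k → a mod suc k ≡ b mod suc k
  mod-cong a b eq = toℕ-injective (trans (toℕ-fromℕ< _) (trans eq (sym (toℕ-fromℕ< _))))

  at-index : ∀ x → C (toℕ x) ≡ c x
  at-index x = cong c (toℕ-injective (trans (toℕ-fromℕ< _) (m<n⇒m%n≡m (toℕ<n x))))

  periodic : ∀ i → C (suc k + i) ≡ C i
  periodic i = cong c (mod-cong (suc k + i) i (trans (cong (_% suc k) (+-comm (suc k) i)) ([m+n]%n≡m%n i (suc k))))

  arc : ∀ i → E (C i) (C (suc i))
  arc i = subst (λ x → E (C i) (c x)) next≡ (proj₂ cycle (i mod suc k))
    where
    next≡ : next (i mod suc k) ≡ suc i mod suc k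
    next≡ = mod-cong (suc (toℕ (i mod suc k))) (suc i) (begin
      suc (toℕ (i mod suc k)) % suc k          ≡⟨ cong (λ x → suc x % suc k) (toℕ-fromℕ< _) ⟩
      suc (i % suc k) % suc k                  ≡⟨ sym ([m+kn]%n≡m%n (suc (i % suc k)) (i / suc k) (suc k)) ⟩
      (suc (i % suc k) + i / suc k * suc k) % suc k ≡⟨ cong (λ x → suc x % suc k) (sym (m≡m%n+[m/n]*n i (suc k))) ⟩
      suc i % suc k                            ∎)
      where open ≡-Reasoning

  injective-on-period : ∀ i j → i < suc k → j < suc k → C i ≡ C j → i ≡ j
  injective-on-period i j i< j< Ci≡Cj = begin
    i                    ≡⟨ sym (m<n⇒m%n≡m i<) ⟩
    i % suc k            ≡⟨ sym (toℕ-fromℕ< _) ⟩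
    toℕ (i mod suc k)    ≡⟨ cong toℕ (proj₁ cycle Ci≡Cj) ⟩
    toℕ (j mod suc k)    ≡⟨ toℕ-fromℕ< _ ⟩
    j % suc k            ≡⟨ m<n⇒m%n≡m j< ⟩
    j                    ∎
    where open ≡-Reasoning

  cyclic : Cyclic E k C
  cyclic = record
    { periodic = periodic
    ; arc = arc
    ; no-repeat = Periodic.no-short-repeat (suc k) C periodic injective-on-period
    }

module Paths {n : ℕ} (E : Digraph n) where

  open import Data.List.Membership.DecPropositional (_≟_ {n = n}) using (_∈?_)

  data Path : Fin n → Fin n → Set where
    [] : ∀ {a} → Path a a
    _∷_ : ∀ {a b c} → E a b → Path b c → Path a c

  visited : ∀ {a b} → Path a b → List (Fin n)
  visited [] = []
  visited (_∷_ {b = b} _ P) = b ∷ visited P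

  len : ∀ {a b} → Path a b → ℕ
  len P = length (visited P)

  Simple : ∀ {a b} → Path a b → Set
  Simple {a} P = Unique (a ∷ visited P)

  suffix-from : ∀ {a b x} (P : Path a b) → Simple P → x ∈ a ∷ visited P → ∃ λ (Q : Path x b) → Simple Q
  suffix-from P simple (here refl) = P , simple
  suffix-from (_ ∷ P) (_ ∷ simple) (there x∈) = suffix-from P simple x∈

  -- Every walk can be shortened to a simple path by cutting out the loops.
  simple-path : ∀ {a b} → Star E a b → ∃ λ (P : Path a b) → Simple P
  simple-path ε = [] , [] ∷ []
  simple-path {a} (e ◅ walk) with simple-path walk
  ... | P , simple with a ∈? _ ∷ visited P
  ...   | yes a∈ = suffix-from P simple a∈
  ...   | no a∉ = e ∷ P , ¬Any⇒All¬ _ a∉ ∷ simple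

  -- Going round a path P from w to v and back along an arc v → w, forever.
  module Closing {w v : Fin n} (P : Path w v) (back : E v w) where

    position : ∀ {a} → ℕ → Path a v → Fin n
    position {a} zero _ = a
    position (suc i) [] = position i P
    position (suc i) (_ ∷ Q) = position i Q

    position-periodic : ∀ {a} (Q : Path a v) i → position (suc (len Q) + i) Q ≡ position i P
    position-periodic [] i = refl
    position-periodic (_ ∷ Q) i = position-periodic Q i

    position-arc : ∀ {a} (Q : Path a v) i → E (position i Q) (position (suc i) Q)
    position-arc [] zero = back
    position-arc [] (suc i) = position-arc P i
    position-arc (e ∷ _) zero = e
    position-arc (_ ∷ Q) (suc i) = position-arc Q i

    position-end : ∀ {a} (Q : Path a v) → position (len Q) Q ≡ v
    position-end [] = refl
    position-end (_ ∷ Q) = position-end Q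

    position-visited : ∀ {a} (Q : Path a v) i → i < len Q → position (suc i) Q ∈ visited Q
    position-visited (_ ∷ Q) zero _ = here refl
    position-visited (_ ∷ Q) (suc i) (s≤s i<) = there (position-visited Q i i<)

    position-injective : ∀ {a} (Q : Path a v) → Simple Q → ∀ i j → i < suc (len Q) → j < suc (len Q) →
                         position i Q ≡ position j Q → i ≡ j
    position-injective Q _ zero zero _ _ _ = refl
    position-injective Q (a∉ ∷ _) zero (suc j) _ (s≤s j<) eq =
      ⊥-elim (all-lookup a∉ (position-visited Q j j<) eq)
    position-injective Q (a∉ ∷ _) (suc i) zero (s≤s i<) _ eq =
      ⊥-elim (all-lookup a∉ (position-visited Q i i<) (sym eq))
    position-injective (_ ∷ Q) (_ ∷ simple) (suc i) (suc j) (s≤s i<) (s≤s j<) eq =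
      cong suc (position-injective Q simple i j i< j< eq)

    cyclic : Simple P → Cyclic E (len P) (λ i → position i P)
    cyclic simple = record
      { periodic = position-periodic P
      ; arc = position-arc P
      ; no-repeat = Periodic.no-short-repeat (suc (len P)) _ (position-periodic P) (position-injective P simple)
      }

  arc-on-cycle : StronglyConnected E → ∀ {v w} → E v w → v ≢ w →
                 ∃ λ k → ∃ λ C → Cyclic E (suc k) C × C 0 ≡ w × C (suc k) ≡ v
  arc-on-cycle connected {v} {w} back v≢w with simple-path (connected w v)
  ... | [] , _ = ⊥-elim (v≢w refl)
  ... | P@(_ ∷ Q) , simple = len Q , (λ i → position i P) , cyclic simple , refl , position-end Q
    where open Closing P back

cycle-transport : ∀ {n} {E : Digraph n} {k c} → IsCycle E k c → ∀ f b → f (c b) ≡ hole →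
                  ∀ i j → ∃ λ g → Moves E f g × g (c j) ≡ f (c i)
cycle-transport {E = E} {k} {c} cycle f b fb i j
  with reach-position (toℕ b) f (trans (cong f (at-index b)) fb) (toℕ i) (toℕ j)
  where open CycleWalk E k c cycle
        open Rotation E cyclic
... | g , ms , moved = g , ms , trans (cong g (sym (at-index j))) (trans moved (cong f (at-index i)))
  where open CycleWalk E k c cycle

undo-move : ∀ {n} {E : Digraph n} → StronglyConnected E → ∀ {f f′} → Move E f f′ →
            ∃ λ g → Moves E f′ g × g ≗ f
undo-move {E = E} connected {f} (move v w e v-full w-hole) with arc-on-cycle connected e v≢w
  where
  open Paths E
  v≢w : v ≢ w
  v≢w refl = v-full w-hole
... | k , C , cyc , refl , refl with complete-rotation cyc f w-hole
...   | g , f′→g , rotated with iterate (suc k) 1 g (trans (proj₁ rotated 0) w-hole)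
  where open Rotation E cyc
...     | g′ , g→g′ , rotated′ = g′ , f′→g ◅◅ g→g′ , full-turn (rotated-compose rotated rotated′)
  where open Rotation E cyc

move-preserves-reachability : ∀ {n} {E : Digraph n} → StronglyConnected E → ∀ t {f f′} →
                              Move E f f′ → CanReach E f t ⇔ CanReach E f′ t
move-preserves-reachability {E = E} connected t {f} {f′} m = mk⇔ forward backward
  where
  backward : CanReach E f′ t → CanReach E f t
  backward (g , ms , at-t) = g , m ◅ ms , at-t
  forward : CanReach E f t → CanReach E f′ t
  forward (g , ms , at-t) with undo-move connected m
  ... | h , f′→h , h≗f with moves-transport ms (λ x → sym (h≗f x))
  ...   | g′ , h→g′ , g≗g′ = g′ , f′→h ◅◅ h→g′ , trans (sym (g≗g′ t)) at-t

proposition1 : ∀ {n} (E : Digraph n) → Loopless E → StronglyConnected E → (t : Fin n) →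
    ((f : Config n) → ExactlyOneRobot f → (k : ℕ) (c : Fin (suc k) → Fin n) → IsCycle E k c →
       (∃ λ i → f (c i) ≡ robot) → (∃ λ j → f (c j) ≡ hole) →
       (j : Fin (suc k)) → CanReach E f (c j))
    ×
    ((f f' : Config n) → ExactlyOneRobot f → Move E f f' → (CanReach E f t ⇔ CanReach E f' t))
proposition1 E _ connected t =
  (λ f _ k c cycle (i , robot-at-i) (b , hole-at-b) j →
     let g , ms , moved = cycle-transport cycle f b hole-at-b i j in g , ms , trans moved robot-at-i) ,
  (λ _ _ _ → move-preserves-reachability connected t)
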